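{- Let $d>1$ be a constant, let $1<p\le n^{d-1}$ with $n$ and $p$ powers of $2^{d-1}$, and consider any algorithm evaluating, without recomputation, all nodes of the $d$-dimensional array DAG of size $n$ on a BSP with $p$ processors. Consider an $\ell$-owned block $B$ adjacent to a block $B'$ that is either shared or $\ell'$-owned with $\ell'\ne\ell$. Then the number of messages exchanged by processor $P_\ell$ for evaluating nodes in $B$ and $B'$ is $\Omega(n^{d-1}/p)$.
   Context: BSP model: $p$ processors $P_0,\dots,P_{p-1}$ with unbounded private memories, communicating by messages (one data word each) in supersteps separated by global synchronizations. The $d$-dimensional array DAG of size $n$ has nodes $\langle i_0,\dots,i_{d-1}\rangle$, $0\le i_k<n$, with an arc from $\langle i_0,\dots,i_k,\dots,i_{d-1}\rangle$ to $\langle i_0,\dots,i_k+1,\dots,i_{d-1}\rangle$ whenever $i_k+1<n$; a node can be evaluated by a processor only once the values of all its predecessors are available to it; "without recomputation" means every node is evaluated exactly once. The array is partitioned into $p^{d/(d-1)}$ blocks $B_{i_0,\dots,i_{d-1}}$, $0\le i_k<p^{1/(d-1)}$, where $B_{i_0,\dots,i_{d-1}}$ consists of the nodes $\langle i'_0,\dots,i'_{d-1}\rangle$ with $i_k n/p^{1/(d-1)}\le i'_k<(i_k+1)n/p^{1/(d-1)}$ for all $k$; each block has $n^d/p^{d/(d-1)}$ nodes. A block is $\ell$-owned if more than half of its nodes are evaluated by $P_\ell$; it is owned if it is $\ell$-owned for some $\ell$, and shared otherwise. Two blocks are adjacent if their index tuples differ in exactly one coordinate $k$, and there by exactly $1$.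 Constants in $\Omega$ may depend on $d$. -}

module Defs where

open import Data.Nat using (ℕ; zero; suc; _+_; _*_; _∸_; _^_; _≤_; _<_; _≤?_; _<?_)
open import Data.Fin using (Fin; toℕ; _≟_)
open import Data.Fin.Properties using (all?)
open import Data.List using (List; []; _∷_; map; concatMap; allFin; length; filter)
open import Data.List.Membership.Propositional using (_∈_)
open import Data.Product using (Σ; ∃; ∃-syntax; _×_; _,_)
open import Data.Sum using (_⊎_)
import Data.Vec.Functional as VF
open import Relation.Nullary using (¬_; Dec)
open import Relation.Nullary.Decidable using (_×-dec_; _⊎-dec_)
open import Relation.Binary.PropositionalEquality using (_≡_; _≢_)

IsPowerOf : ℕ → ℕ → Set
IsPowerOf b n = ∃[ a ] (n ≡ b ^ a)

Node : ℕ → ℕ → Set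
Node d n = Fin d → Fin n

allNodes : (d n : ℕ) → List (Node d n)
allNodes zero n = (λ ()) ∷ []
allNodes (suc d) n = concatMap (λ j → map (λ x → j VF.∷ x) (allNodes d n)) (allFin n)

Arc : {d n : ℕ} → Node d n → Node d n → Set
Arc {d} u v = ∃[ k ] (toℕ (v k) ≡ suc (toℕ (u k)) × (∀ k′ → k′ ≢ k → u k′ ≡ v k′))

-- a message carries one data word: the value of one node
record Msg (d n p : ℕ) : Set where
  constructor msg
  field
    src   : Fin p
    dst   : Fin p
    val   : Node d n
    sstep : ℕ         -- superstep in which it is sent (available from sstep+1)

open Msg public

Available : {d n p : ℕ} → (Node d n → Fin p) → (Node d n → ℕ) → List (Msg d n p)
          → Fin p → Node d n → ℕ → Set
Available eval stage msgs q u s =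
  (eval u ≡ q × stage u ≤ s)
  ⊎ (∃[ m ] (m ∈ msgs × val m ≡ u × dst m ≡ q × sstep m < s))

-- a BSP algorithm evaluating every node of the array exactly once
-- (no recomputation: evaluating processor is a function of the node)
record BSPAlg (d n p : ℕ) : Set where
  field
    eval   : Node d n → Fin p
    stage  : Node d n → ℕ
    msgs   : List (Msg d n p)
    arc-ok : ∀ u v → Arc u v → Available eval stage msgs (eval v) u (stage v)
    msg-ok : ∀ m → m ∈ msgs → Available eval stage msgs (src m) (val m) (sstep m)

open BSPAlg public

-- Blocks: s = p^{1/(d-1)} blocks per side; node x ∈ B_i iff for all k,
-- i_k n/s ≤ x_k < (i_k+1) n/s  (multiplied through by s)
InBlock : {d n : ℕ} → (s : ℕ) → (Fin d → Fin s) → Node d n → Set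
InBlock {d} {n} s i x =
  ∀ k → (toℕ (i k) * n ≤ toℕ (x k) * s) × (toℕ (x k) * s < suc (toℕ (i k)) * n)

inBlock? : {d n : ℕ} → (s : ℕ) → (i : Fin d → Fin s) → (x : Node d n) → Dec (InBlock s i x)
inBlock? {d} {n} s i x =
  all? (λ k → (toℕ (i k) * n ≤? toℕ (x k) * s) ×-dec (toℕ (x k) * s <? suc (toℕ (i k)) * n))

blockSize : (d n s : ℕ) → (Fin d → Fin s) → ℕ
blockSize d n s i = length (filter (inBlock? {d} {n} s i) (allNodes d n))

ownCount : {d n p : ℕ} → BSPAlg d n p → (s : ℕ) → Fin p → (Fin d → Fin s) → ℕ
ownCount {d} {n} A s ℓ i =
  length (filter (λ x → inBlock? s i x ×-dec (eval A x ≟ ℓ)) (allNodes d n))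

Owned : {d n p : ℕ} → BSPAlg d n p → (s : ℕ) → Fin p → (Fin d → Fin s) → Set
Owned {d} {n} A s ℓ i = blockSize d n s i < 2 * ownCount A s ℓ i

Shared : {d n p : ℕ} → BSPAlg d n p → (s : ℕ) → (Fin d → Fin s) → Set
Shared {p = p} A s i = ¬ (∃[ ℓ ] Owned A s ℓ i)

Adjacent : {d s : ℕ} → (Fin d → Fin s) → (Fin d → Fin s) → Set
Adjacent {d} i j =
  ∃[ k ] ((suc (toℕ (i k)) ≡ toℕ (j k) ⊎ suc (toℕ (j k)) ≡ toℕ (i k))
          × (∀ k′ → k′ ≢ k → i k′ ≡ j k′))

exchanged : {d n p : ℕ} → BSPAlg d n p → (s : ℕ) → Fin p → (Fin d → Fin s) → (Fin d → Fin s) → ℕ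
exchanged A s ℓ i j =
  length (filter (λ m → ((src m ≟ ℓ) ⊎-dec (dst m ≟ ℓ))
                        ×-dec (inBlock? s i (val m) ⊎-dec inBlock? s j (val m)))
                 (msgs A))

module Submission where

-- Let U = B ∪ B′; for adjacent blocks this is a box whose sides have at most 2m nodes, where
-- m = n / p^{1/(d-1)} is the side of a block. Colour a node of U by whether P_ℓ evaluates it.
-- As B is ℓ-owned and B′ is not, each colour class has at least m^d / 2 nodes. A discrete
-- isoperimetric inequality, proved by induction on the dimension by comparing parallel slices,
-- bounds the product of the two classes by d · 2m · |U| · |∂U|, where ∂U contains the tail of every
-- arc of U joining nodes of different colours; hence |∂U| ≥ m^{d-1} / (16 d). The value of such a
-- tail must be sent or received by P_ℓ, so ∂U is covered by the messages exchanged by P_ℓ, and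
-- m^{d-1} = n^{d-1} / p gives the bound with constant 16 d.

open import Defs
open import Data.Bool.Base using (Bool; true; false; T; _∧_; _∨_; not; if_then_else_)
open import Data.Bool.ListAction using (any)
open import Data.Bool.Properties using (∧-assoc; ∧-identityʳ; T-∧)
import Data.Bool.Properties as Bool
open import Data.Empty using (⊥; ⊥-elim)
open import Data.Fin.Base using (Fin; zero; suc; toℕ; fromℕ<)
open import Data.Fin.Properties using (_≟_; toℕ<n; toℕ-fromℕ<; fromℕ<-toℕ)
open import Data.List.Base using (List; []; _∷_; _++_; map; filter; length; concatMap; tabulate; allFin)
open import Data.List.Membership.Propositional using (_∈_; lose)
open import Data.List.Properties using (map-++; map-∘)
open import Data.List.Relation.Unary.Any.Properties using (any⁺)
open import Data.Nat.Base using (ℕ; zero; suc; _+_; _*_; _∸_; _^_; _≤_; _<_; _<ᵇ_; z≤n; s≤s; s≤s⁻¹; NonZero)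
open import Data.Nat.Induction using (<-wellFounded)
import Data.Nat.ListAction as List
open import Data.Nat.ListAction.Properties using (sum-++)
open import Data.Nat.Properties hiding (_≟_)
open import Data.Nat.Tactic.RingSolver using (solve-∀)
open import Data.Product.Base using (_×_; _,_; proj₁; proj₂; ∃-syntax)
open import Data.Sum.Base using (_⊎_; inj₁; inj₂)
import Data.Sum.Base as Sum
open import Data.Unit.Base using (tt)
import Data.Vec.Functional as Vec
open import Function.Base using (_∘_)
open import Function.Bundles using (_⇔_; mk⇔; Equivalence)
import Function.Properties.Equivalence as ⇔
open import Induction.WellFounded using (Acc; acc)
open import Relation.Binary.Definitions using (tri<; tri≈; tri>)
open import Relation.Binary.PropositionalEquality
open import Relation.Nullary.Decidable using (Dec; does; yes; no; _×-dec_; _⊎-dec_; T?; does-⇔)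
open import Relation.Unary using (Pred; Decidable)

open import Algebra.Properties.CommutativeSemigroup *-commutativeSemigroup using (x∙yz≈y∙xz)
open import Algebra.Properties.Semiring.Sum +-*-semiring
  using (sum; sum-syntax; sum-cong-≗; ∑-distrib-+; ∑-comm; *-distribˡ-sum; *-distribʳ-sum; sum-replicate-zero)

minority-complement : ∀ o r {v} → o + r ≡ v → 2 * o ≤ v → v ≤ 2 * r
minority-complement o r refl 2o≤o+r = begin
  o + r ≤⟨ +-monoˡ-≤ r (+-cancelˡ-≤ o o r (subst (_≤ o + r) (cong (o +_) (+-identityʳ o)) 2o≤o+r)) ⟩
  r + r ≡⟨ cong (r +_) (+-identityʳ r) ⟨
  2 * r ∎
  where open ≤-Reasoning

outnumbered : ∀ o o′ {v} → o + o′ ≤ v → v < 2 * o′ → 2 * o ≤ v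
outnumbered o o′ {v} o+o′≤v v<2o′ = <⇒≤ (+-cancelʳ-< v (2 * o) v (begin-strict
  2 * o + v      <⟨ +-monoʳ-< (2 * o) v<2o′ ⟩
  2 * o + 2 * o′ ≡⟨ *-distribˡ-+ 2 o o′ ⟨
  2 * (o + o′)   ≤⟨ *-monoʳ-≤ 2 o+o′≤v ⟩
  2 * v          ≡⟨ cong (v +_) (+-identityʳ v) ⟩
  v + v          ∎))
  where open ≤-Reasoning

square-bound : ∀ {X a b V t E} d m .{{_ : NonZero X}} → X ≤ 2 * a → X ≤ 2 * b →
               a * b ≤ d * (2 * m) * V * t → V ≤ 2 * X → t ≤ E → X ≤ m * (16 * d * E)
square-bound {X} {a} {b} {V} {t} {E} d m X≤2a X≤2b ab≤ V≤2X t≤E = *-cancelˡ-≤ X (begin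
  X * X                           ≤⟨ *-mono-≤ X≤2a X≤2b ⟩
  (2 * a) * (2 * b)               ≡⟨ [m*n]*[o*p]≡[m*o]*[n*p] 2 a 2 b ⟩
  4 * (a * b)                     ≤⟨ *-monoʳ-≤ 4 ab≤ ⟩
  4 * (d * (2 * m) * V * t)       ≤⟨ *-monoʳ-≤ 4 (*-mono-≤ (*-monoʳ-≤ (d * (2 * m)) V≤2X) t≤E) ⟩
  4 * (d * (2 * m) * (2 * X) * E) ≡⟨ rearrange d m X E ⟩
  X * (m * (16 * d * E))          ∎)
  where
  open ≤-Reasoning
  rearrange : ∀ d m X E → 4 * (d * (2 * m) * (2 * X) * E) ≡ X * (m * (16 * d * E))
  rearrange = solve-∀

^-injectiveˡ : ∀ e .{{_ : NonZero e}} {x y} → x ^ e ≡ y ^ e → x ≡ y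
^-injectiveˡ e {x} {y} eq with <-cmp x y
... | tri< x<y _ _ = ⊥-elim (<⇒≢ (^-monoˡ-< e x<y) eq)
... | tri≈ _ x≡y _ = x≡y
... | tri> _ _ y<x = ⊥-elim (<⇒≢ (^-monoˡ-< e y<x) (sym eq))

^-cancelʳ-≤ : ∀ e .{{_ : NonZero e}} {x y} → x ^ e ≤ y ^ e → x ≤ y
^-cancelʳ-≤ e x^e≤y^e = ≮⇒≥ (λ y<x → <⇒≱ (^-monoˡ-< e y<x) x^e≤y^e)

^-cancelˡ-≤ : ∀ b → 1 < b → ∀ {x y} → b ^ x ≤ b ^ y → x ≤ y
^-cancelˡ-≤ b 1<b b^x≤b^y = ≮⇒≥ (λ y<x → <⇒≱ (^-monoʳ-< b 1<b y<x) b^x≤b^y)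

^-distribʳ-* : ∀ x y e → (x * y) ^ e ≡ x ^ e * y ^ e
^-distribʳ-* x y zero    = refl
^-distribʳ-* x y (suc e) =
  trans (cong (x * y *_) (^-distribʳ-* x y e)) ([m*n]*[o*p]≡[m*o]*[n*p] x y (x ^ e) (y ^ e))

𝟙 : Bool → ℕ
𝟙 b = if b then 1 else 0

𝟙≤1 : ∀ b → 𝟙 b ≤ 1
𝟙≤1 true  = ≤-refl
𝟙≤1 false = z≤n

𝟙-true : ∀ {b} → T b → 𝟙 b ≡ 1
𝟙-true {true} _ = refl

𝟙-∧ : ∀ a b → 𝟙 (a ∧ b) ≡ 𝟙 a * 𝟙 b
𝟙-∧ true  b = sym (*-identityˡ (𝟙 b))
𝟙-∧ false b = refl

𝟙-∨ : ∀ a b → 𝟙 (a ∨ b) ≤ 𝟙 a + 𝟙 b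
𝟙-∨ true  b = s≤s z≤n
𝟙-∨ false b = ≤-refl

𝟙-mono : ∀ {a b} → (T a → T b) → 𝟙 a ≤ 𝟙 b
𝟙-mono {false}        _   = z≤n
𝟙-mono {true} {true}  _   = ≤-refl
𝟙-mono {true} {false} a⇒b = ⊥-elim (a⇒b tt)

T-≢ : ∀ {a b} → T a → T (not b) → a ≢ b
T-≢ {true} {false} _ _ ()

T-does : ∀ {p} {P : Set p} (P? : Dec P) → P → T (does P?)
T-does (yes _) _ = tt
T-does (no ¬p) p = ¬p p

T-does⁻¹ : ∀ {p} {P : Set p} (P? : Dec P) → T (does P?) → P
T-does⁻¹ (yes p) _ = p

∑-mono-≤ : ∀ {n} {f g : Fin n → ℕ} → (∀ i → f i ≤ g i) → sum f ≤ sum g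
∑-mono-≤ {zero}  _   = z≤n
∑-mono-≤ {suc n} f≤g = +-mono-≤ (f≤g zero) (∑-mono-≤ (f≤g ∘ suc))

∑-𝟙-mono-≤ : ∀ {n} (R : Fin n → Bool) {f g : Fin n → ℕ} → (∀ i → T (R i) → f i ≤ g i) →
             ∑[ i < n ] (𝟙 (R i) * f i) ≤ ∑[ i < n ] (𝟙 (R i) * g i)
∑-𝟙-mono-≤ R f≤g = ∑-mono-≤ (λ i → guarded (R i) (f≤g i))
  where
  guarded : ∀ b {x y} → (T b → x ≤ y) → 𝟙 b * x ≤ 𝟙 b * y
  guarded true  x≤y = *-monoʳ-≤ 1 (x≤y tt)
  guarded false _   = z≤n

term≤∑ : ∀ {n} (f : Fin n → ℕ) i → f i ≤ sum f
term≤∑ f zero    = m≤m+n _ _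
term≤∑ f (suc i) = ≤-trans (term≤∑ (f ∘ suc) i) (m≤n+m _ _)

∑-𝟙-≟ : ∀ {n} (i : Fin n) → ∑[ j < n ] 𝟙 (does (i ≟ j)) ≡ 1
∑-𝟙-≟ {suc n} zero    = cong suc (sum-replicate-zero n)
∑-𝟙-≟ {suc n} (suc i) = ∑-𝟙-≟ i

∑-weighted : ∀ {m} (r e : Fin m → ℕ) L c K →
             ∑[ j < m ] (r j * (L * (c * e j + K))) ≡ L * (c * ∑[ j < m ] (r j * e j) + sum r * K)
∑-weighted {zero}  r e L c K = empty L c K
  where
  empty : ∀ L c K → 0 ≡ L * (c * 0 + 0 * K)
  empty = solve-∀
∑-weighted {suc m} r e L c K =
  trans (cong (r zero * (L * (c * e zero + K)) +_) (∑-weighted (r ∘ suc) (e ∘ suc) L c K))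
        (step L c K (r zero) (e zero) (∑[ j < m ] (r (suc j) * e (suc j))) (sum (r ∘ suc)))
  where
  step : ∀ L c K r₀ e₀ S R →
         r₀ * (L * (c * e₀ + K)) + L * (c * S + R * K) ≡ L * (c * (r₀ * e₀ + S) + (r₀ + R) * K)
  step = solve-∀

module _ {A : Set} where

  length-filter : ∀ {p} {P : Pred A p} (P? : Decidable P) xs →
                  length (filter P? xs) ≡ List.sum (map (𝟙 ∘ does ∘ P?) xs)
  length-filter P? []       = refl
  length-filter P? (x ∷ xs) with does (P? x)
  ... | true  = cong suc (length-filter P? xs)
  ... | false = length-filter P? xs

  sum-map-tabulate : ∀ {n} (f : A → ℕ) (g : Fin n → A) → List.sum (map f (tabulate g)) ≡ ∑[ j < n ] f (g j)
  sum-map-tabulate {zero}  f g = refl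
  sum-map-tabulate {suc n} f g = cong (f (g zero) +_) (sum-map-tabulate f (g ∘ suc))

  sum-map-concatMap : ∀ {B : Set} (f : B → ℕ) (g : A → List B) xs →
                      List.sum (map f (concatMap g xs)) ≡ List.sum (map (List.sum ∘ map f ∘ g) xs)
  sum-map-concatMap f g []       = refl
  sum-map-concatMap f g (x ∷ xs) = begin
    List.sum (map f (g x ++ concatMap g xs))                   ≡⟨ cong List.sum (map-++ f (g x) _) ⟩
    List.sum (map f (g x) ++ map f (concatMap g xs))           ≡⟨ sum-++ (map f (g x)) _ ⟩
    List.sum (map f (g x)) + List.sum (map f (concatMap g xs)) ≡⟨ cong (_ +_) (sum-map-concatMap f g xs) ⟩
    List.sum (map (List.sum ∘ map f ∘ g) (x ∷ xs))             ∎
    where open ≡-Reasoning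

Interval : Set
Interval = ℕ × ℕ

-- Written with `lo <ᵇ suc c` rather than `lo ≤ᵇ c` so that shifting the interval and the point by
-- one is a definitional equality, which intervalSize≡ uses.
inInterval : Interval → ℕ → Bool
inInterval (lo , hi) c = (c <ᵇ hi) ∧ (lo <ᵇ suc c)

T-inInterval : ∀ {lo hi c} → T (inInterval (lo , hi) c) ⇔ (lo ≤ c × c < hi)
T-inInterval {lo} {hi} {c} = mk⇔ to from
  where
  to : T (inInterval (lo , hi) c) → lo ≤ c × c < hi
  to t = let c<hi , lo<1+c = Equivalence.to T-∧ t in s≤s⁻¹ (<ᵇ⇒< lo (suc c) lo<1+c) , <ᵇ⇒< c hi c<hi
  from : lo ≤ c × c < hi → T (inInterval (lo , hi) c)
  from (lo≤c , c<hi) = Equivalence.from T-∧ (<⇒<ᵇ c<hi , <⇒<ᵇ (s≤s lo≤c))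

inInterval-convex : ∀ I {a b c} → T (inInterval I a) → T (inInterval I b) → a ≤ c → c ≤ b →
                    T (inInterval I c)
inInterval-convex (lo , hi) a∈I b∈I a≤c c≤b =
  Equivalence.from T-inInterval
    ( ≤-trans (proj₁ (Equivalence.to (T-inInterval {lo} {hi}) a∈I)) a≤c
    , ≤-<-trans c≤b (proj₂ (Equivalence.to (T-inInterval {lo} {hi}) b∈I)))

intervalSize : ℕ → Interval → ℕ
intervalSize n I = ∑[ c < n ] 𝟙 (inInterval I (toℕ c))

intervalSize≡ : ∀ n lo hi → hi ≤ n → intervalSize n (lo , hi) ≡ hi ∸ lo
intervalSize≡ zero    lo      zero    _       = sym (0∸n≡0 lo)
intervalSize≡ (suc n) lo      zero    _       = trans (sum-replicate-zero (suc n)) (sym (0∸n≡0 lo))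
intervalSize≡ (suc n) zero    (suc h) 1+h≤1+n = cong suc (intervalSize≡ n zero h (s≤s⁻¹ 1+h≤1+n))
intervalSize≡ (suc n) (suc l) (suc h) 1+h≤1+n = intervalSize≡ n l h (s≤s⁻¹ 1+h≤1+n)

crossing-ℕ : ∀ (f : ℕ → Bool) {a b} → a ≤ b → f a ≢ f b → ∃[ c ] (a ≤ c × c < b × f c ≢ f (suc c))
crossing-ℕ f {b = zero}  z≤n   fa≢fb   = ⊥-elim (fa≢fb refl)
crossing-ℕ f {a} {suc b} a≤1+b fa≢f1+b = last-step (f b Bool.≟ f (suc b))
  where
  a≤b : a ≤ b
  a≤b = s≤s⁻¹ (≤∧≢⇒< a≤1+b (λ { refl → fa≢f1+b refl }))
  last-step : Dec (f b ≡ f (suc b)) → ∃[ c ] (a ≤ c × c < suc b × f c ≢ f (suc c))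
  last-step (no fb≢f1+b)  = b , a≤b , n<1+n b , fb≢f1+b
  last-step (yes fb≡f1+b) =
    let c , a≤c , c<b , fc≢f1+c = crossing-ℕ f a≤b (λ fa≡fb → fa≢f1+b (trans fa≡fb fb≡f1+b))
    in  c , a≤c , m<n⇒m<1+n c<b , fc≢f1+c

module _ {n : ℕ} where

  extend : (Fin n → Bool) → ℕ → Bool
  extend h c with c <? n
  ... | yes c<n = h (fromℕ< c<n)
  ... | no  _   = false

  extend-fromℕ< : ∀ h {c} (c<n : c < n) → extend h c ≡ h (fromℕ< c<n)
  extend-fromℕ< h {c} c<n with c <? n
  ... | yes _   = refl
  ... | no  c≮n = ⊥-elim (c≮n c<n)

  extend-toℕ : ∀ h (c : Fin n) → extend h (toℕ c) ≡ h c
  extend-toℕ h c = trans (extend-fromℕ< h (toℕ<n c)) (cong h (fromℕ<-toℕ c (toℕ<n c)))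

  Crossing : (Fin n → Bool) → Interval → Set
  Crossing h I = ∃[ c ] ∃[ c′ ]
    (toℕ c′ ≡ suc (toℕ c) × T (inInterval I (toℕ c)) × T (inInterval I (toℕ c′)) × h c ≢ h c′)

  crossing-Fin-≤ : ∀ (h : Fin n → Bool) I {a b : Fin n} →
                   T (inInterval I (toℕ a)) → T (inInterval I (toℕ b)) → toℕ a ≤ toℕ b → h a ≢ h b → Crossing h I
  crossing-Fin-≤ h I {a} {b} a∈I b∈I a≤b ha≢hb = toFin (crossing-ℕ (extend h) a≤b extend-ha≢hb)
    where
    extend-ha≢hb : extend h (toℕ a) ≢ extend h (toℕ b)
    extend-ha≢hb eq = ha≢hb (trans (sym (extend-toℕ h a)) (trans eq (extend-toℕ h b)))

    toFin : ∃[ c ] (toℕ a ≤ c × c < toℕ b × extend h c ≢ extend h (suc c)) → Crossing h I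
    toFin (c , a≤c , c<b , hc≢h1+c) =
      fromℕ< c<n , fromℕ< 1+c<n , trans c′≡1+c (cong suc (sym c≡c)) ,
      inInterval-convex I a∈I b∈I (subst (toℕ a ≤_) (sym c≡c) a≤c)
                                   (subst (_≤ toℕ b) (sym c≡c) (<⇒≤ c<b)) ,
      inInterval-convex I a∈I b∈I (subst (toℕ a ≤_) (sym c′≡1+c) (m≤n⇒m≤1+n a≤c))
                                   (subst (_≤ toℕ b) (sym c′≡1+c) c<b) ,
      λ eq → hc≢h1+c (trans (extend-fromℕ< h c<n) (trans eq (sym (extend-fromℕ< h 1+c<n))))
      where
      c<n = <-trans c<b (toℕ<n b)
      1+c<n = ≤-<-trans c<b (toℕ<n b)
      c≡c = toℕ-fromℕ< c<n
      c′≡1+c = toℕ-fromℕ< 1+c<n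

  crossing-Fin : ∀ (h : Fin n → Bool) I {j j′ : Fin n} →
                 T (inInterval I (toℕ j)) → T (inInterval I (toℕ j′)) → h j ≢ h j′ → Crossing h I
  crossing-Fin h I {j} {j′} j∈I j′∈I hj≢hj′ with ≤-total (toℕ j) (toℕ j′)
  ... | inj₁ j≤j′ = crossing-Fin-≤ h I j∈I j′∈I j≤j′ hj≢hj′
  ... | inj₂ j′≤j = crossing-Fin-≤ h I j′∈I j∈I j′≤j (hj≢hj′ ∘ sym)

Box : ℕ → Set
Box d = Fin d → Interval

Arc-∷ : ∀ {d n} (j : Fin n) {g g′ : Node d n} → Arc g g′ → Arc (j Vec.∷ g) (j Vec.∷ g′)
Arc-∷ j (k , step , fixed) = suc k , step , λ { zero _ → refl ; (suc k′) k′≢k → fixed k′ (k′≢k ∘ cong suc) }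

Arc-head : ∀ {d n} {c c′ : Fin n} (g : Node d n) → toℕ c′ ≡ suc (toℕ c) → Arc (c Vec.∷ g) (c′ Vec.∷ g)
Arc-head g step = zero , step , λ { zero 0≢0 → ⊥-elim (0≢0 refl) ; (suc k′) _ → refl }

module _ {n : ℕ} where

  nodeSum : ∀ d → (Node d n → ℕ) → ℕ
  nodeSum zero    f = f (λ ())
  nodeSum (suc d) f = ∑[ j < n ] nodeSum d (f ∘ (j Vec.∷_))

  nodeSum-cong : ∀ d {f g : Node d n → ℕ} → (∀ x → f x ≡ g x) → nodeSum d f ≡ nodeSum d g
  nodeSum-cong zero    f≗g = f≗g _
  nodeSum-cong (suc d) f≗g = sum-cong-≗ (λ j → nodeSum-cong d (f≗g ∘ (j Vec.∷_)))

  nodeSum-mono-≤ : ∀ d {f g : Node d n → ℕ} → (∀ x → f x ≤ g x) → nodeSum d f ≤ nodeSum d g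
  nodeSum-mono-≤ zero    f≤g = f≤g _
  nodeSum-mono-≤ (suc d) f≤g = ∑-mono-≤ (λ j → nodeSum-mono-≤ d (f≤g ∘ (j Vec.∷_)))

  nodeSum-zero : ∀ d → nodeSum d (λ _ → 0) ≡ 0
  nodeSum-zero zero    = refl
  nodeSum-zero (suc d) = trans (sum-cong-≗ {n} (λ _ → nodeSum-zero d)) (sum-replicate-zero n)

  nodeSum-distrib-+ : ∀ d (f g : Node d n → ℕ) → nodeSum d (λ x → f x + g x) ≡ nodeSum d f + nodeSum d g
  nodeSum-distrib-+ zero    f g = refl
  nodeSum-distrib-+ (suc d) f g =
    trans (sum-cong-≗ (λ j → nodeSum-distrib-+ d (f ∘ (j Vec.∷_)) (g ∘ (j Vec.∷_))))
          (∑-distrib-+ (λ j → nodeSum d (f ∘ (j Vec.∷_))) (λ j → nodeSum d (g ∘ (j Vec.∷_))))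

  *-distribˡ-nodeSum : ∀ d c (f : Node d n → ℕ) → c * nodeSum d f ≡ nodeSum d (λ x → c * f x)
  *-distribˡ-nodeSum zero    c f = refl
  *-distribˡ-nodeSum (suc d) c f =
    trans (*-distribˡ-sum c (λ j → nodeSum d (f ∘ (j Vec.∷_))))
          (sum-cong-≗ (λ j → *-distribˡ-nodeSum d c (f ∘ (j Vec.∷_))))

  nodeSum-∑-comm : ∀ d {m} (f : Node d n → Fin m → ℕ) →
                   nodeSum d (λ x → ∑[ c < m ] f x c) ≡ ∑[ c < m ] nodeSum d (λ x → f x c)
  nodeSum-∑-comm zero    f = refl
  nodeSum-∑-comm (suc d) f =
    trans (sum-cong-≗ (λ j → nodeSum-∑-comm d (f ∘ (j Vec.∷_))))
          (∑-comm (λ j c → nodeSum d (λ g → f (j Vec.∷ g) c)))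

  sum-map-allNodes : ∀ d (f : Node d n → ℕ) → List.sum (map f (allNodes d n)) ≡ nodeSum d f
  sum-map-allNodes zero    f = +-identityʳ _
  sum-map-allNodes (suc d) f = begin
    List.sum (map f (concatMap slice (allFin n)))
      ≡⟨ sum-map-concatMap f slice (allFin n) ⟩
    List.sum (map (List.sum ∘ map f ∘ slice) (allFin n))
      ≡⟨ sum-map-tabulate (List.sum ∘ map f ∘ slice) (λ j → j) ⟩
    ∑[ j < n ] List.sum (map f (slice j))
      ≡⟨ sum-cong-≗ {n} (λ j → cong List.sum (sym (map-∘ (allNodes d n)))) ⟩
    ∑[ j < n ] List.sum (map (f ∘ (j Vec.∷_)) (allNodes d n))
      ≡⟨ sum-cong-≗ (λ j → sum-map-allNodes d (f ∘ (j Vec.∷_))) ⟩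
    nodeSum (suc d) f
      ∎
    where
    open ≡-Reasoning
    slice : Fin n → List (Node (suc d) n)
    slice j = map (j Vec.∷_) (allNodes d n)

  count-allNodes : ∀ d {p} {P : Pred (Node d n) p} (P? : Decidable P) →
                   length (filter P? (allNodes d n)) ≡ nodeSum d (𝟙 ∘ does ∘ P?)
  count-allNodes d P? = trans (length-filter P? (allNodes d n)) (sum-map-allNodes d _)

  sameNode : ∀ {d} → Node d n → Node d n → Bool
  sameNode {zero}  _ _ = true
  sameNode {suc d} u v = does (u zero ≟ v zero) ∧ sameNode (Vec.tail u) (Vec.tail v)

  sameNode-refl : ∀ {d} (u : Node d n) → T (sameNode u u)
  sameNode-refl {zero}  u = tt
  sameNode-refl {suc d} u with u zero ≟ u zero
  ... | yes _  = sameNode-refl (Vec.tail u)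
  ... | no u≢u = u≢u refl

  nodeSum-sameNode : ∀ d (u : Node d n) → nodeSum d (𝟙 ∘ sameNode u) ≡ 1
  nodeSum-sameNode zero    u = refl
  nodeSum-sameNode (suc d) u = begin
    ∑[ j < n ] nodeSum d (λ g → 𝟙 (does (u zero ≟ j) ∧ sameNode (Vec.tail u) g))
      ≡⟨ sum-cong-≗ (λ j → trans (nodeSum-cong d (λ g → 𝟙-∧ (does (u zero ≟ j)) _))
                                 (sym (*-distribˡ-nodeSum d (𝟙 (does (u zero ≟ j))) _))) ⟩
    ∑[ j < n ] (𝟙 (does (u zero ≟ j)) * nodeSum d (𝟙 ∘ sameNode (Vec.tail u)))
      ≡⟨ sum-cong-≗ (λ j → trans (cong (𝟙 (does (u zero ≟ j)) *_) (nodeSum-sameNode d (Vec.tail u)))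
                                 (*-identityʳ _)) ⟩
    ∑[ j < n ] 𝟙 (does (u zero ≟ j))
      ≡⟨ ∑-𝟙-≟ (u zero) ⟩
    1 ∎
    where open ≡-Reasoning

  nodeSum-any-≤ : ∀ d {M : Set} (q : M → Bool) (v : M → Node d n) ms →
    nodeSum d (λ x → 𝟙 (any (λ m → q m ∧ sameNode (v m) x) ms)) ≤ List.sum (map (𝟙 ∘ q) ms)
  nodeSum-any-≤ d q v []       = ≤-reflexive (nodeSum-zero d)
  nodeSum-any-≤ d q v (m ∷ ms) = begin
    nodeSum d (λ x → 𝟙 (hit m x ∨ any (λ m′ → hit m′ x) ms))
      ≤⟨ nodeSum-mono-≤ d (λ x → 𝟙-∨ (hit m x) _) ⟩
    nodeSum d (λ x → 𝟙 (hit m x) + 𝟙 (any (λ m′ → hit m′ x) ms))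
      ≡⟨ nodeSum-distrib-+ d (𝟙 ∘ hit m) _ ⟩
    nodeSum d (𝟙 ∘ hit m) + nodeSum d (λ x → 𝟙 (any (λ m′ → hit m′ x) ms))
      ≤⟨ +-mono-≤ (≤-reflexive hits-of-m) (nodeSum-any-≤ d q v ms) ⟩
    𝟙 (q m) + List.sum (map (𝟙 ∘ q) ms) ∎
    where
    open ≤-Reasoning
    hit : _ → Node d n → Bool
    hit m x = q m ∧ sameNode (v m) x
    hits-of-m : nodeSum d (𝟙 ∘ hit m) ≡ 𝟙 (q m)
    hits-of-m = begin-equality
      nodeSum d (𝟙 ∘ hit m)                            ≡⟨ nodeSum-cong d (λ x → 𝟙-∧ (q m) _) ⟩
      nodeSum d (λ x → 𝟙 (q m) * 𝟙 (sameNode (v m) x)) ≡⟨ *-distribˡ-nodeSum d (𝟙 (q m)) _ ⟨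
      𝟙 (q m) * nodeSum d (𝟙 ∘ sameNode (v m))         ≡⟨ cong (𝟙 (q m) *_) (nodeSum-sameNode d (v m)) ⟩
      𝟙 (q m) * 1                                      ≡⟨ *-identityʳ (𝟙 (q m)) ⟩
      𝟙 (q m)                                          ∎

  inBox : ∀ {d} → Box d → Node d n → Bool
  inBox {zero}  B x = true
  inBox {suc d} B x = inInterval (B zero) (toℕ (x zero)) ∧ inBox (Vec.tail B) (Vec.tail x)

  _∈ᴮ_ : ∀ {d} → Node d n → Box d → Set
  x ∈ᴮ B = ∀ k → proj₁ (B k) ≤ toℕ (x k) × toℕ (x k) < proj₂ (B k)

  T-inBox : ∀ {d} {B : Box d} {x : Node d n} → T (inBox B x) ⇔ x ∈ᴮ B
  T-inBox {d} {B} {x} = mk⇔ (to d B x) (from d B x)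
    where
    to : ∀ d B x → T (inBox {d} B x) → x ∈ᴮ B
    to (suc d) B x x∈B zero    = Equivalence.to T-inInterval (proj₁ (Equivalence.to T-∧ x∈B))
    to (suc d) B x x∈B (suc k) = to d (Vec.tail B) (Vec.tail x) (proj₂ (Equivalence.to T-∧ x∈B)) k
    from : ∀ d B x → x ∈ᴮ B → T (inBox {d} B x)
    from zero    B x _  = tt
    from (suc d) B x x∈ =
      Equivalence.from T-∧ (Equivalence.from T-inInterval (x∈ zero) , from d (Vec.tail B) (Vec.tail x) (x∈ ∘ suc))

  boxCount : ∀ {d} → Box d → (Node d n → Bool) → ℕ
  boxCount {d} B φ = nodeSum d (λ x → 𝟙 (inBox B x ∧ φ x))

  volume : ∀ {d} → Box d → ℕ
  volume B = boxCount B (λ _ → true)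

  boxCount-slices : ∀ {d} (B : Box (suc d)) (φ : Node (suc d) n → Bool) →
    boxCount B φ ≡ ∑[ j < n ] (𝟙 (inInterval (B zero) (toℕ j)) * boxCount (Vec.tail B) (φ ∘ (j Vec.∷_)))
  boxCount-slices {d} B φ = sum-cong-≗ {n} λ j →
    let r = inInterval (B zero) (toℕ j) in
    trans (nodeSum-cong d (λ g → trans (cong 𝟙 (∧-assoc r (inBox (Vec.tail B) g) (φ (j Vec.∷ g))))
                                        (𝟙-∧ r (inBox (Vec.tail B) g ∧ φ (j Vec.∷ g)))))
          (sym (*-distribˡ-nodeSum d (𝟙 r) (λ g → 𝟙 (inBox (Vec.tail B) g ∧ φ (j Vec.∷ g)))))

  boxCount-mono-≤ : ∀ {d} {B B′ : Box d} (φ : Node d n → Bool) → (∀ {x} → x ∈ᴮ B → x ∈ᴮ B′) →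
                    boxCount B φ ≤ boxCount B′ φ
  boxCount-mono-≤ {d} φ B⊆B′ = nodeSum-mono-≤ d λ x → 𝟙-mono λ t →
    let x∈B , φx = Equivalence.to T-∧ t
    in  Equivalence.from T-∧ (Equivalence.from T-inBox (B⊆B′ (Equivalence.to T-inBox x∈B)) , φx)

  boxCount≤volume : ∀ {d} (B : Box d) (φ : Node d n → Bool) → boxCount B φ ≤ volume B
  boxCount≤volume {d} B φ = nodeSum-mono-≤ d λ x →
    𝟙-mono (λ t → Equivalence.from T-∧ (proj₁ (Equivalence.to T-∧ t) , tt))

  boxCount≤nodeSum : ∀ {d} (B : Box d) (φ : Node d n → Bool) → boxCount B φ ≤ nodeSum d (𝟙 ∘ φ)
  boxCount≤nodeSum {d} B φ = nodeSum-mono-≤ d (λ x → 𝟙-mono (proj₂ ∘ Equivalence.to T-∧))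

  boxCount-split : ∀ {d} (B : Box d) (φ : Node d n → Bool) → boxCount B φ + boxCount B (not ∘ φ) ≡ volume B
  boxCount-split {d} B φ =
    trans (sym (nodeSum-distrib-+ d _ _)) (nodeSum-cong d λ x → split (inBox B x) (φ x))
    where
    split : ∀ b c → 𝟙 (b ∧ c) + 𝟙 (b ∧ not c) ≡ 𝟙 (b ∧ true)
    split false c     = refl
    split true  true  = refl
    split true  false = refl

  volume-⊆-∪ : ∀ {d} (B B₁ B₂ : Box d) → (∀ {x} → x ∈ᴮ B → x ∈ᴮ B₁ ⊎ x ∈ᴮ B₂) →
               volume B ≤ volume B₁ + volume B₂
  volume-⊆-∪ {d} B B₁ B₂ B⊆B₁∪B₂ =
    ≤-trans (nodeSum-mono-≤ d pointwise) (≤-reflexive (nodeSum-distrib-+ d (λ x → 𝟙 (inBox B₁ x ∧ true)) _))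
    where
    ∈B⇒T : ∀ {B′ : Box d} {x} → x ∈ᴮ B′ → T (inBox B′ x ∧ true)
    ∈B⇒T x∈B′ = Equivalence.from T-∧ (Equivalence.from T-inBox x∈B′ , tt)
    pointwise : ∀ x → 𝟙 (inBox B x ∧ true) ≤ 𝟙 (inBox B₁ x ∧ true) + 𝟙 (inBox B₂ x ∧ true)
    pointwise x with inBox B x in x∈B
    ... | false = z≤n
    ... | true  with B⊆B₁∪B₂ (Equivalence.to T-inBox (subst T (sym x∈B) tt))
    ...   | inj₁ x∈B₁ = ≤-trans (≤-reflexive (sym (𝟙-true (∈B⇒T x∈B₁)))) (m≤m+n _ _)
    ...   | inj₂ x∈B₂ = ≤-trans (≤-reflexive (sym (𝟙-true (∈B⇒T x∈B₂)))) (m≤n+m _ _)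

  boxCount-disjoint : ∀ {d} (B : Box d) (φ ψ : Node d n → Bool) → (∀ x → T (φ x) → T (ψ x) → ⊥) →
                      boxCount B φ + boxCount B ψ ≤ volume B
  boxCount-disjoint {d} B φ ψ disjoint =
    ≤-trans (≤-reflexive (sym (nodeSum-distrib-+ d _ _))) (nodeSum-mono-≤ d pointwise)
    where
    pointwise : ∀ x → 𝟙 (inBox B x ∧ φ x) + 𝟙 (inBox B x ∧ ψ x) ≤ 𝟙 (inBox B x ∧ true)
    pointwise x with inBox B x | φ x | ψ x | disjoint x
    ... | false | _     | _     | _         = z≤n
    ... | true  | false | _     | _         = 𝟙≤1 _
    ... | true  | true  | false | _         = ≤-refl
    ... | true  | true  | true  | disjoint-x = ⊥-elim (disjoint-x tt tt)

  volume-uniform : ∀ {d} (B : Box d) m → (∀ k → intervalSize n (B k) ≡ m) → volume B ≡ m ^ d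
  volume-uniform {zero}  B m sides = refl
  volume-uniform {suc d} B m sides = begin
    volume B
      ≡⟨ boxCount-slices B (λ _ → true) ⟩
    ∑[ j < n ] (𝟙 (inInterval (B zero) (toℕ j)) * volume (Vec.tail B))
      ≡⟨ *-distribʳ-sum {n} (volume (Vec.tail B)) (λ j → 𝟙 (inInterval (B zero) (toℕ j))) ⟨
    intervalSize n (B zero) * volume (Vec.tail B)
      ≡⟨ cong₂ _*_ (sides zero) (volume-uniform (Vec.tail B) m (sides ∘ suc)) ⟩
    m * m ^ d
      ∎
    where open ≡-Reasoning

  -- A discrete isoperimetric inequality

  CrossingsCovered : ∀ {d} → Box d → (χ S : Node d n → Bool) → Set
  CrossingsCovered B χ S =
    ∀ x y → Arc x y → T (inBox B x) → T (inBox B y) → χ x ≢ χ y → T (S x)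

  crossingsCovered-slice : ∀ {d} {B : Box (suc d)} {χ S : Node (suc d) n → Bool} → CrossingsCovered B χ S →
    ∀ {j} → T (inInterval (B zero) (toℕ j)) → CrossingsCovered (Vec.tail B) (χ ∘ (j Vec.∷_)) (S ∘ (j Vec.∷_))
  crossingsCovered-slice covered {j} j∈I g g′ arc g∈B g′∈B =
    covered _ _ (Arc-∷ j arc) (Equivalence.from T-∧ (j∈I , g∈B)) (Equivalence.from T-∧ (j∈I , g′∈B))

  -- On every line through g parallel to the first axis along which χ differs at j and j′, some arc of
  -- B crosses χ, and its tail lies in S.
  boxCount-slice-≤ : ∀ {d} (B : Box (suc d)) (χ S : Node (suc d) n → Bool) → CrossingsCovered B χ S →
    ∀ {j j′} → T (inInterval (B zero) (toℕ j)) → T (inInterval (B zero) (toℕ j′)) →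
    boxCount (Vec.tail B) (χ ∘ (j Vec.∷_)) ≤ boxCount (Vec.tail B) (χ ∘ (j′ Vec.∷_)) + boxCount B S
  boxCount-slice-≤ {d} B χ S covered {j} {j′} j∈I j′∈I = begin
    boxCount B′ (χ ∘ (j Vec.∷_))
      ≤⟨ nodeSum-mono-≤ d (λ g → pointwise (inBox B′ g) (χ (j Vec.∷ g)) (χ (j′ Vec.∷ g)) (line-crossed g)) ⟩
    nodeSum d (λ g → 𝟙 (inBox B′ g ∧ χ (j′ Vec.∷ g)) + line g)
      ≡⟨ nodeSum-distrib-+ d _ line ⟩
    boxCount B′ (χ ∘ (j′ Vec.∷_)) + nodeSum d line
      ≡⟨ cong (boxCount B′ (χ ∘ (j′ Vec.∷_)) +_) (nodeSum-∑-comm d (λ g c → on-line g c)) ⟩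
    boxCount B′ (χ ∘ (j′ Vec.∷_)) + boxCount B S ∎
    where
    open ≤-Reasoning
    B′ = Vec.tail B
    on-line : Node d n → Fin n → ℕ
    on-line g c = 𝟙 (inBox B (c Vec.∷ g) ∧ S (c Vec.∷ g))
    line : Node d n → ℕ
    line g = ∑[ c < n ] on-line g c

    pointwise : ∀ u x y {s} → (T u → T x → T (not y) → 1 ≤ s) → 𝟙 (u ∧ x) ≤ 𝟙 (u ∧ y) + s
    pointwise false _     _     _       = z≤n
    pointwise true  false _     _       = z≤n
    pointwise true  true  true  _       = s≤s z≤n
    pointwise true  true  false crossed = crossed tt tt tt

    line-crossed : ∀ g → T (inBox B′ g) → T (χ (j Vec.∷ g)) → T (not (χ (j′ Vec.∷ g))) → 1 ≤ line g
    line-crossed g g∈B′ χj χj′ with crossing-Fin (λ c → χ (c Vec.∷ g)) (B zero) j∈I j′∈I (T-≢ χj χj′)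
    ... | c , c′ , step , c∈I , c′∈I , χc≢χc′ = begin
      1            ≡⟨ 𝟙-true (Equivalence.from T-∧ (cg∈B , covered _ _ (Arc-head g step) cg∈B c′g∈B χc≢χc′)) ⟨
      on-line g c  ≤⟨ term≤∑ (on-line g) c ⟩
      line g       ∎
      where
      cg∈B = Equivalence.from T-∧ (c∈I , g∈B′)
      c′g∈B = Equivalence.from T-∧ (c′∈I , g∈B′)


  isoperimetric : ∀ d (B : Box d) (χ S : Node d n → Bool) N →
    (∀ k → intervalSize n (B k) ≤ N) → CrossingsCovered B χ S →
    boxCount B χ * boxCount B (not ∘ χ) ≤ d * N * volume B * boxCount B S
  isoperimetric zero B χ S N _ _ = ≤-reflexive (𝟙*𝟙-not (χ (λ ())))
    where
    𝟙*𝟙-not : ∀ b → 𝟙 b * 𝟙 (not b) ≡ 0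
    𝟙*𝟙-not true  = refl
    𝟙*𝟙-not false = refl
  -- Writing a j, b j, e j for the counts in slice j: every a i ≤ a j + E, so A · b j ≤ L · (a j + E) · b j,
  -- and the induction hypothesis bounds a j · b j inside slice j.
  isoperimetric (suc d) B χ S N sides covered = begin
    A * boxCount B (not ∘ χ)
      ≡⟨ cong (A *_) (boxCount-slices B (not ∘ χ)) ⟩
    A * ∑[ j < n ] (r j * b j)
      ≡⟨ *-distribˡ-sum A (λ j → r j * b j) ⟩
    ∑[ j < n ] (A * (r j * b j))
      ≡⟨ sum-cong-≗ {n} (λ j → x∙yz≈y∙xz A (r j) (b j)) ⟩
    ∑[ j < n ] (r j * (A * b j))
      ≤⟨ ∑-𝟙-mono-≤ R A*b≤ ⟩
    ∑[ j < n ] (r j * (L * ((a j + E) * b j)))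
      ≤⟨ ∑-𝟙-mono-≤ R (λ j j∈I → *-monoʳ-≤ L (slice-bound j j∈I)) ⟩
    ∑[ j < n ] (r j * (L * (d * N * W * e j + E * W)))
      ≡⟨ ∑-weighted r e L (d * N * W) (E * W) ⟩
    L * (d * N * W * ∑[ j < n ] (r j * e j) + L * (E * W))
      ≡⟨ cong (λ x → L * (d * N * W * x + L * (E * W))) (boxCount-slices B S) ⟨
    L * (d * N * W * E + L * (E * W))
      ≤⟨ *-monoʳ-≤ L (+-monoʳ-≤ (d * N * W * E) (*-monoˡ-≤ (E * W) (sides zero))) ⟩
    L * (d * N * W * E + N * (E * W))
      ≡⟨ rearrange d L N W E ⟩
    suc d * N * (L * W) * E
      ≡⟨ cong (λ v → suc d * N * v * E) volume≡L*W ⟨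
    suc d * N * volume B * E
      ∎
    where
    open ≤-Reasoning
    B′ = Vec.tail B
    R : Fin n → Bool
    R j = inInterval (B zero) (toℕ j)
    r a b e : Fin n → ℕ
    r j = 𝟙 (R j)
    a j = boxCount B′ (χ ∘ (j Vec.∷_))
    b j = boxCount B′ (not ∘ χ ∘ (j Vec.∷_))
    e j = boxCount B′ (S ∘ (j Vec.∷_))
    A E L W : ℕ
    A = boxCount B χ
    E = boxCount B S
    L = intervalSize n (B zero)
    W = volume B′

    volume≡L*W : volume B ≡ L * W
    volume≡L*W = trans (boxCount-slices B (λ _ → true)) (sym (*-distribʳ-sum {n} W r))

    A≤ : ∀ j → T (R j) → A ≤ L * (a j + E)
    A≤ j j∈I = begin
      A                            ≡⟨ boxCount-slices B χ ⟩
      ∑[ i < n ] (r i * a i)       ≤⟨ ∑-𝟙-mono-≤ R (λ i i∈I → boxCount-slice-≤ B χ S covered i∈I j∈I) ⟩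
      ∑[ i < n ] (r i * (a j + E)) ≡⟨ *-distribʳ-sum {n} (a j + E) r ⟨
      L * (a j + E)                ∎

    A*b≤ : ∀ j → T (R j) → A * b j ≤ L * ((a j + E) * b j)
    A*b≤ j j∈I = ≤-trans (*-monoˡ-≤ (b j) (A≤ j j∈I)) (≤-reflexive (*-assoc L (a j + E) (b j)))

    slice-bound : ∀ j → T (R j) → (a j + E) * b j ≤ d * N * W * e j + E * W
    slice-bound j j∈I = begin
      (a j + E) * b j         ≡⟨ *-distribʳ-+ (b j) (a j) E ⟩
      a j * b j + E * b j     ≤⟨ +-mono-≤ induction-hypothesis (*-monoʳ-≤ E (boxCount≤volume B′ _)) ⟩
      d * N * W * e j + E * W ∎
      where
      induction-hypothesis : a j * b j ≤ d * N * W * e j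
      induction-hypothesis = isoperimetric d B′ (χ ∘ (j Vec.∷_)) (S ∘ (j Vec.∷_)) N (sides ∘ suc)
                                           (crossingsCovered-slice {B = B} {χ} {S} covered j∈I)

    rearrange : ∀ d L N W E → L * (d * N * W * E + N * (E * W)) ≡ suc d * N * (L * W) * E
    rearrange = solve-∀

-- Messages forced by the BSP semantics

module _ {d n p : ℕ} (A : BSPAlg d n p) where

  evaluatedBy : Fin p → Node d n → Bool
  evaluatedBy ℓ x = does (eval A x ≟ ℓ)

  SentByEvaluator : Node d n → Set
  SentByEvaluator x = ∃[ m ] (m ∈ msgs A × val m ≡ x × src m ≡ eval A x)

  evaluator-sends : ∀ m → m ∈ msgs A → SentByEvaluator (val m)
  evaluator-sends m m∈ = go m m∈ (<-wellFounded (sstep m))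
    where
    go : ∀ m → m ∈ msgs A → Acc _<_ (sstep m) → SentByEvaluator (val m)
    go m m∈ (acc earlier) with msg-ok A m m∈
    ... | inj₁ (evaluated , _) = m , m∈ , refl , sym evaluated
    ... | inj₂ (m₀ , m₀∈ , val≡ , _ , m₀-earlier) =
      let m′ , m′∈ , val′≡ , src′≡ = go m₀ m₀∈ (earlier m₀-earlier)
      in  m′ , m′∈ , trans val′≡ val≡ , trans src′≡ (cong (eval A) val≡)

  arc-message : ∀ ℓ {x y} → Arc x y → evaluatedBy ℓ x ≢ evaluatedBy ℓ y →
                ∃[ m ] (m ∈ msgs A × val m ≡ x × (src m ≡ ℓ ⊎ dst m ≡ ℓ))
  arc-message ℓ {x} {y} arc differ with eval A x ≟ ℓ | eval A y ≟ ℓ | arc-ok A x y arc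
  ... | yes _   | yes _   | _              = ⊥-elim (differ refl)
  ... | no  _   | no  _   | _              = ⊥-elim (differ refl)
  ... | yes x≡ℓ | no  y≢ℓ | inj₁ (x≡y , _) = ⊥-elim (y≢ℓ (trans (sym x≡y) x≡ℓ))
  ... | no  x≢ℓ | yes y≡ℓ | inj₁ (x≡y , _) = ⊥-elim (x≢ℓ (trans x≡y y≡ℓ))
  ... | no  _   | yes y≡ℓ | inj₂ (m , m∈ , val≡x , dst≡y , _) = m , m∈ , val≡x , inj₂ (trans dst≡y y≡ℓ)
  ... | yes x≡ℓ | no  _   | inj₂ (m , m∈ , val≡x , _) =
    let m′ , m′∈ , val′≡ , src′≡ = evaluator-sends m m∈
    in  m′ , m′∈ , trans val′≡ val≡x , inj₁ (trans src′≡ (trans (cong (eval A) val≡x) x≡ℓ))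

  module _ (s : ℕ) (ℓ : Fin p) (i j : Fin d → Fin s) where

    exchanged? : (m : Msg d n p) →
                 Dec ((src m ≡ ℓ ⊎ dst m ≡ ℓ) × (InBlock s i (val m) ⊎ InBlock s j (val m)))
    exchanged? m = ((src m ≟ ℓ) ⊎-dec (dst m ≟ ℓ)) ×-dec (inBlock? s i (val m) ⊎-dec inBlock? s j (val m))

    carried : Node d n → Bool
    carried x = any (λ m → does (exchanged? m) ∧ sameNode (val m) x) (msgs A)

    nodeSum-carried≤exchanged : nodeSum d (𝟙 ∘ carried) ≤ exchanged A s ℓ i j
    nodeSum-carried≤exchanged =
      ≤-trans (nodeSum-any-≤ d (does ∘ exchanged?) val (msgs A))
              (≤-reflexive (sym (length-filter exchanged? (msgs A))))

    carried-covers : (B : Box d) → (∀ {x} → x ∈ᴮ B → InBlock s i x ⊎ InBlock s j x) →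
                     CrossingsCovered B (evaluatedBy ℓ) carried
    carried-covers B B⊆blocks x y arc x∈B _ differ =
      let m , m∈ , val≡x , sent-or-received = arc-message ℓ arc differ
          in-blocks = subst (λ z → InBlock s i z ⊎ InBlock s j z) (sym val≡x)
                            (B⊆blocks (Equivalence.to T-inBox x∈B))
      in  any⁺ _ (lose m∈ (Equivalence.from T-∧
            ( T-does (exchanged? m) (sent-or-received , in-blocks)
            , subst (T ∘ sameNode (val m)) val≡x (sameNode-refl (val m)))))

blockBox : ∀ {d s} → ℕ → (Fin d → Fin s) → Box d
blockBox m i k = toℕ (i k) * m , suc (toℕ (i k)) * m

module Blocks {n s m : ℕ} .{{_ : NonZero s}} (n≡m*s : n ≡ m * s) where

  scaled-interval : ∀ t u c → (t * n ≤ c * s × c * s < u * n) ⇔ (t * m ≤ c × c < u * m)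
  scaled-interval t u c = mk⇔
    (λ (lo , hi) → *-cancelʳ-≤ (t * m) c s (subst (_≤ c * s) (rescale t) lo) ,
                   *-cancelʳ-< s c (u * m) (subst (c * s <_) (rescale u) hi))
    (λ (lo , hi) → subst (_≤ c * s) (sym (rescale t)) (*-monoˡ-≤ s lo) ,
                   subst (c * s <_) (sym (rescale u)) (*-monoˡ-< s hi))
    where
    rescale : ∀ t → t * n ≡ t * m * s
    rescale t = trans (cong (t *_) n≡m*s) (sym (*-assoc t m s))

  InBlock⇔∈blockBox : ∀ {d} (i : Fin d → Fin s) (x : Node d n) → InBlock s i x ⇔ x ∈ᴮ blockBox m i
  InBlock⇔∈blockBox i x = mk⇔
    (λ x∈ k → Equivalence.to (scaled-interval (toℕ (i k)) (suc (toℕ (i k))) (toℕ (x k))) (x∈ k))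
    (λ x∈ k → Equivalence.from (scaled-interval (toℕ (i k)) (suc (toℕ (i k))) (toℕ (x k))) (x∈ k))

  does-inBlock? : ∀ {d} (i : Fin d → Fin s) (x : Node d n) → does (inBlock? s i x) ≡ inBox (blockBox m i) x
  does-inBlock? i x = does-⇔ (⇔.trans (InBlock⇔∈blockBox i x) (⇔.sym T-inBox)) (inBlock? s i x) (T? _)

  block-top≤n : (t : Fin s) → suc (toℕ t) * m ≤ n
  block-top≤n t = ≤-trans (*-monoˡ-≤ m (toℕ<n t)) (≤-reflexive (trans (*-comm s m) (sym n≡m*s)))

  volume-blockBox : ∀ {d} (i : Fin d → Fin s) → volume {n} (blockBox m i) ≡ m ^ d
  volume-blockBox i = volume-uniform (blockBox m i) m λ k →
    trans (intervalSize≡ n (toℕ (i k) * m) _ (block-top≤n (i k))) (m+n∸n≡m m (toℕ (i k) * m))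

  blockSize≡ : ∀ {d} (i : Fin d → Fin s) → blockSize d n s i ≡ m ^ d
  blockSize≡ {d} i = begin
    blockSize d n s i                       ≡⟨ count-allNodes d (inBlock? s i) ⟩
    nodeSum d (𝟙 ∘ does ∘ inBlock? s i)
      ≡⟨ nodeSum-cong d (λ x → cong 𝟙 (trans (does-inBlock? i x) (sym (∧-identityʳ _)))) ⟩
    volume (blockBox m i)                   ≡⟨ volume-blockBox i ⟩
    m ^ d                                   ∎
    where open ≡-Reasoning

  ownCount≡ : ∀ {d p} (A : BSPAlg d n p) ℓ (i : Fin d → Fin s) →
              ownCount A s ℓ i ≡ boxCount (blockBox m i) (evaluatedBy A ℓ)
  ownCount≡ {d} A ℓ i = trans (count-allNodes d _)
    (nodeSum-cong d (λ x → cong (λ b → 𝟙 (b ∧ evaluatedBy A ℓ x)) (does-inBlock? i x)))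

  record UnionBox {d} (i j : Fin d → Fin s) : Set where
    field
      hull        : Box d
      blockˡ⊆hull : ∀ {x : Node d n} → x ∈ᴮ blockBox m i → x ∈ᴮ hull
      blockʳ⊆hull : ∀ {x : Node d n} → x ∈ᴮ blockBox m j → x ∈ᴮ hull
      hull⊆blocks : ∀ {x : Node d n} → x ∈ᴮ hull → x ∈ᴮ blockBox m i ⊎ x ∈ᴮ blockBox m j
      hull-sides  : ∀ k → intervalSize n (hull k) ≤ 2 * m

  unionBox-swap : ∀ {d} {i j : Fin d → Fin s} → UnionBox i j → UnionBox j i
  unionBox-swap U = record
    { hull        = hull
    ; blockˡ⊆hull = blockʳ⊆hull
    ; blockʳ⊆hull = blockˡ⊆hull
    ; hull⊆blocks = Sum.swap ∘ hull⊆blocks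
    ; hull-sides  = hull-sides
    }
    where open UnionBox U

  unionBox-step : ∀ {d} {i j : Fin d → Fin s} K → suc (toℕ (i K)) ≡ toℕ (j K) → (∀ k → k ≢ K → i k ≡ j k) →
                  UnionBox i j
  unionBox-step {d} {i} {j} K step same = record
    { hull        = hull
    ; blockˡ⊆hull = λ x∈ k → proj₁ (x∈ k) , <-≤-trans (proj₂ (x∈ k)) (*-monoˡ-≤ m (s≤s (i≤j k)))
    ; blockʳ⊆hull = λ x∈ k → ≤-trans (*-monoˡ-≤ m (i≤j k)) (proj₁ (x∈ k)) , proj₂ (x∈ k)
    ; hull⊆blocks = hull⊆blocks
    ; hull-sides  = hull-sides
    }
    where
    off-K : ∀ {k} → k ≢ K → toℕ (i k) ≡ toℕ (j k)
    off-K k≢K = cong toℕ (same _ k≢K)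

    i≤j : ∀ k → toℕ (i k) ≤ toℕ (j k)
    i≤j k with k ≟ K
    ... | yes refl = ≤-trans (n≤1+n _) (≤-reflexive step)
    ... | no  k≢K  = ≤-reflexive (off-K k≢K)

    j≤1+i : ∀ k → toℕ (j k) ≤ suc (toℕ (i k))
    j≤1+i k with k ≟ K
    ... | yes refl = ≤-reflexive (sym step)
    ... | no  k≢K  = ≤-trans (≤-reflexive (sym (off-K k≢K))) (n≤1+n _)

    hull : Box d
    hull k = toℕ (i k) * m , suc (toℕ (j k)) * m

    hull⊆blocks : ∀ {x : Node d n} → x ∈ᴮ hull → x ∈ᴮ blockBox m i ⊎ x ∈ᴮ blockBox m j
    hull⊆blocks {x} x∈ with toℕ (x K) <? suc (toℕ (i K)) * m
    ... | yes x<top = inj₁ (λ k → proj₁ (x∈ k) , upper k)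
      where
      upper : ∀ k → toℕ (x k) < suc (toℕ (i k)) * m
      upper k with k ≟ K
      ... | yes refl = x<top
      ... | no  k≢K  = subst (λ t → toℕ (x k) < suc t * m) (sym (off-K k≢K)) (proj₂ (x∈ k))
    ... | no  x≮top = inj₂ (λ k → lower k , proj₂ (x∈ k))
      where
      lower : ∀ k → toℕ (j k) * m ≤ toℕ (x k)
      lower k with k ≟ K
      ... | yes refl = subst (λ t → t * m ≤ toℕ (x K)) step (≮⇒≥ x≮top)
      ... | no  k≢K  = subst (λ t → t * m ≤ toℕ (x k)) (off-K k≢K) (proj₁ (x∈ k))

    hull-sides : ∀ k → intervalSize n (hull k) ≤ 2 * m
    hull-sides k = begin
      intervalSize n (hull k)                    ≡⟨ intervalSize≡ n (toℕ (i k) * m) _ (block-top≤n (j k)) ⟩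
      suc (toℕ (j k)) * m ∸ toℕ (i k) * m        ≡⟨ *-distribʳ-∸ m (suc (toℕ (j k))) (toℕ (i k)) ⟨
      (suc (toℕ (j k)) ∸ toℕ (i k)) * m          ≤⟨ *-monoˡ-≤ m (≤-trans (∸-monoˡ-≤ (toℕ (i k)) (s≤s (j≤1+i k)))
                                                                      (≤-reflexive (m+n∸n≡m 2 (toℕ (i k))))) ⟩
      2 * m                                      ∎
      where open ≤-Reasoning

  adjacent⇒unionBox : ∀ {d} {i j : Fin d → Fin s} → Adjacent i j → UnionBox i j
  adjacent⇒unionBox (K , inj₁ step , same) = unionBox-step K step same
  adjacent⇒unionBox (K , inj₂ step , same) = unionBox-swap (unionBox-step K step (λ k k≢K → sym (same k k≢K)))

  module _ {d p} (A : BSPAlg d n p) (ℓ : Fin p) where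

    owned⇒majority : ∀ {i} → Owned A s ℓ i → m ^ d < 2 * boxCount (blockBox m i) (evaluatedBy A ℓ)
    owned⇒majority {i} = subst₂ (λ b o → b < 2 * o) (blockSize≡ i) (ownCount≡ A ℓ i)

    unowned⇒minority : ∀ {j} → Shared A s j ⊎ (∃[ ℓ′ ] (ℓ′ ≢ ℓ × Owned A s ℓ′ j)) →
                       m ^ d ≤ 2 * boxCount (blockBox m j) (not ∘ evaluatedBy A ℓ)
    unowned⇒minority {j} unowned =
      minority-complement _ (boxCount (blockBox m j) (not ∘ evaluatedBy A ℓ))
        (trans (boxCount-split (blockBox m j) (evaluatedBy A ℓ)) (volume-blockBox j)) (minority unowned)
      where
      minority : Shared A s j ⊎ (∃[ ℓ′ ] (ℓ′ ≢ ℓ × Owned A s ℓ′ j)) →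
                 2 * boxCount (blockBox m j) (evaluatedBy A ℓ) ≤ m ^ d
      minority (inj₁ shared) =
        subst₂ (λ o b → 2 * o ≤ b) (ownCount≡ A ℓ j) (blockSize≡ j) (≮⇒≥ (shared ∘ (ℓ ,_)))
      minority (inj₂ (ℓ′ , ℓ′≢ℓ , owned′)) =
        outnumbered _ (boxCount (blockBox m j) (evaluatedBy A ℓ′))
          (≤-trans (boxCount-disjoint (blockBox m j) (evaluatedBy A ℓ) (evaluatedBy A ℓ′) disjoint)
                   (≤-reflexive (volume-blockBox j)))
          (subst₂ (λ b o → b < 2 * o) (blockSize≡ j) (ownCount≡ A ℓ′ j) owned′)
        where
        disjoint : ∀ x → T (evaluatedBy A ℓ x) → T (evaluatedBy A ℓ′ x) → ⊥
        disjoint x by-ℓ by-ℓ′ =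
          ℓ′≢ℓ (trans (sym (T-does⁻¹ (eval A x ≟ ℓ′) by-ℓ′)) (T-does⁻¹ (eval A x ≟ ℓ) by-ℓ))

    exchanged-lower-bound : .{{_ : NonZero m}} {i j : Fin d → Fin s} → Owned A s ℓ i → Adjacent i j →
                            Shared A s j ⊎ (∃[ ℓ′ ] (ℓ′ ≢ ℓ × Owned A s ℓ′ j)) →
                            m ^ d ≤ m * (16 * d * exchanged A s ℓ i j)
    exchanged-lower-bound {i} {j} owned adjacent unowned =
      square-bound {a = boxCount hull χ} {b = boxCount hull (not ∘ χ)} d m {{m^n≢0 m d}}
        (<⇒≤ (<-≤-trans (owned⇒majority {i} owned) (*-monoʳ-≤ 2 (boxCount-mono-≤ χ blockˡ⊆hull))))
        (≤-trans (unowned⇒minority {j} unowned) (*-monoʳ-≤ 2 (boxCount-mono-≤ (not ∘ χ) blockʳ⊆hull)))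
        (isoperimetric d hull χ S (2 * m) hull-sides (carried-covers A s ℓ i j hull hull⊆InBlocks))
        (≤-trans (volume-⊆-∪ hull (blockBox m i) (blockBox m j) hull⊆blocks)
                 (≤-reflexive (cong₂ _+_ (volume-blockBox i) (trans (volume-blockBox j) (sym (+-identityʳ _))))))
        (≤-trans (boxCount≤nodeSum hull S) (nodeSum-carried≤exchanged A s ℓ i j))
      where
      open UnionBox (adjacent⇒unionBox adjacent)
      χ = evaluatedBy A ℓ
      S = carried A s ℓ i j

      hull⊆InBlocks : ∀ {x} → x ∈ᴮ hull → InBlock s i x ⊎ InBlock s j x
      hull⊆InBlocks {x} =
        Sum.map (Equivalence.from (InBlock⇔∈blockBox i x)) (Equivalence.from (InBlock⇔∈blockBox j x)) ∘ hull⊆blocks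

powers-divide : ∀ e .{{_ : NonZero e}} {n p s} → IsPowerOf (2 ^ e) n → IsPowerOf (2 ^ e) p → s ^ e ≡ p →
                p ≤ n ^ e → ∃[ k ] (n ≡ 2 ^ k * s × NonZero s)
powers-divide e {n} {p} {s} (b , n≡[2^e]^b) (a , p≡[2^e]^a) s^e≡p p≤n^e =
  e * b ∸ a , n≡2^k*s , subst NonZero (sym s≡2^a) (m^n≢0 2 a)
  where
  open ≡-Reasoning
  s≡2^a : s ≡ 2 ^ a
  s≡2^a = ^-injectiveˡ e (begin
    s ^ e       ≡⟨ trans s^e≡p p≡[2^e]^a ⟩
    (2 ^ e) ^ a ≡⟨ ^-*-assoc 2 e a ⟩
    2 ^ (e * a) ≡⟨ cong (2 ^_) (*-comm e a) ⟩
    2 ^ (a * e) ≡⟨ ^-*-assoc 2 a e ⟨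
    (2 ^ a) ^ e ∎)
  n≡2^eb : n ≡ 2 ^ (e * b)
  n≡2^eb = trans n≡[2^e]^b (^-*-assoc 2 e b)
  a≤eb : a ≤ e * b
  a≤eb = ^-cancelˡ-≤ 2 (s≤s (s≤s z≤n))
           (subst₂ _≤_ s≡2^a n≡2^eb (^-cancelʳ-≤ e (subst (_≤ n ^ e) (sym s^e≡p) p≤n^e)))
  n≡2^k*s : n ≡ 2 ^ (e * b ∸ a) * s
  n≡2^k*s = begin
    n                       ≡⟨ n≡2^eb ⟩
    2 ^ (e * b)             ≡⟨ cong (2 ^_) (m∸n+n≡m a≤eb) ⟨
    2 ^ (e * b ∸ a + a)     ≡⟨ ^-distribˡ-+-* 2 (e * b ∸ a) a ⟩
    2 ^ (e * b ∸ a) * 2 ^ a ≡⟨ cong (2 ^ (e * b ∸ a) *_) s≡2^a ⟨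
    2 ^ (e * b ∸ a) * s     ∎

lemma4 : (d : ℕ) → 1 < d →
    ∃[ C ] (0 < C ×
    ((n p s : ℕ) →
    IsPowerOf (2 ^ (d ∸ 1)) n → IsPowerOf (2 ^ (d ∸ 1)) p →
    1 < p → p ≤ n ^ (d ∸ 1) →
    s ^ (d ∸ 1) ≡ p →
    (A : BSPAlg d n p) → (ℓ : Fin p) → (i j : Fin d → Fin s) →
    Owned A s ℓ i → Adjacent i j →
    (Shared A s j ⊎ (∃[ ℓ′ ] (ℓ′ ≢ ℓ × Owned A s ℓ′ j))) →
    n ^ (d ∸ 1) ≤ C * (exchanged A s ℓ i j * p)))
lemma4 (suc zero)          (s≤s ())
lemma4 d@(suc (suc e)) _ = 16 * d , s≤s z≤n ,
  λ n p s n-power p-power _ p≤n^e s^e≡p A ℓ i j owned adjacent unowned →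
    let k , n≡m*s , s≢0 = powers-divide (suc e) n-power p-power s^e≡p p≤n^e
        m = 2 ^ k
        E = exchanged A s ℓ i j
        m^e≤16dE : m ^ suc e ≤ 16 * d * E
        m^e≤16dE = *-cancelˡ-≤ m {{m^n≢0 2 k}}
          (Blocks.exchanged-lower-bound {{s≢0}} n≡m*s A ℓ {{m^n≢0 2 k}} owned adjacent unowned)
    in begin
      n ^ suc e             ≡⟨ cong (_^ suc e) n≡m*s ⟩
      (m * s) ^ suc e       ≡⟨ ^-distribʳ-* m s (suc e) ⟩
      m ^ suc e * s ^ suc e ≡⟨ cong (m ^ suc e *_) s^e≡p ⟩
      m ^ suc e * p         ≤⟨ *-monoˡ-≤ p m^e≤16dE ⟩
      16 * d * E * p        ≡⟨ *-assoc (16 * d) E p ⟩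
      16 * d * (E * p)      ∎
  where open ≤-Reasoning
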